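{- For every integer $n\ge 4$, \[ \gamma_{2t}(K_n\Box K_{n+2})=\begin{cases}(3n+4)/2, & n\equiv 0\pmod 2,\\ (3n+3)/2, & n\equiv 1\pmod 4,\\ (3n+5)/2, & n\equiv 3\pmod 4.\end{cases} \]
   Context: $K_n$ denotes the complete graph on $n$ vertices. The Cartesian product $G\Box H$ has vertex set $V(G)\times V(H)$, with $(u_1,v_1)\sim(u_2,v_2)$ iff either $u_1=u_2$ and $v_1\sim v_2$, or $v_1=v_2$ and $u_1\sim u_2$. A set $S$ of vertices of a graph $G$ is total $2$-dominating if every vertex of $G$ is adjacent to at least two vertices of $S$; $\gamma_{2t}(G)$ is the minimum cardinality of such a set. -}

module Defs where

open import Data.Nat using (ℕ; _≤_; _+_; _*_; _/_; _%_)
open import Data.Fin using (Fin)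
open import Data.Fin.Properties using () renaming (_≟_ to _≟ᶠ_)
open import Data.Product using (_×_; _,_)
open import Data.Sum using (_⊎_)
open import Data.List using (List; length; filter)
open import Data.List.Relation.Unary.Unique.Propositional using (Unique)
open import Relation.Binary.PropositionalEquality using (_≡_; _≢_)
open import Relation.Nullary using (Dec)
open import Relation.Nullary.Decidable using (_×-dec_; _⊎-dec_; ¬?)

record Graph : Set₁ where
  field
    V    : Set
    eq?  : (u v : V) → Dec (u ≡ v)
    Adj  : V → V → Set
    adj? : (u v : V) → Dec (Adj u v)

open Graph public

K : ℕ → Graph
K n = record
  { V = Fin n
  ; eq? = _≟ᶠ_
  ; Adj = λ u v → u ≢ v
  ; adj? = λ u v → ¬? (u ≟ᶠ v) }

_□_ : Graph → Graph → Graph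
G □ H = record
  { V = V G × V H
  ; eq? = λ { (u₁ , v₁) (u₂ , v₂) → dprod (eq? G u₁ u₂) (eq? H v₁ v₂) }
  ; Adj = λ { (u₁ , v₁) (u₂ , v₂) →
              (u₁ ≡ u₂ × Adj H v₁ v₂) ⊎ (v₁ ≡ v₂ × Adj G u₁ u₂) }
  ; adj? = λ { (u₁ , v₁) (u₂ , v₂) →
              (eq? G u₁ u₂ ×-dec adj? H v₁ v₂) ⊎-dec (eq? H v₁ v₂ ×-dec adj? G u₁ u₂) } }
  where
  open import Relation.Nullary using (yes; no)
  open import Relation.Binary.PropositionalEquality using (refl)
  dprod : ∀ {a b : V G} {c d : V H} → Dec (a ≡ b) → Dec (c ≡ d) → Dec ((a , c) ≡ (b , d))
  dprod (yes refl) (yes refl) = yes refl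
  dprod (yes refl) (no ¬p) = no λ { refl → ¬p refl }
  dprod (no ¬p) _ = no λ { refl → ¬p refl }

nbrsIn : (G : Graph) → V G → List (V G) → ℕ
nbrsIn G v S = length (filter (adj? G v) S)

-- S (a duplicate-free list, i.e. a finite vertex set) is total 2-dominating:
-- every vertex of G is adjacent to at least two vertices of S.
IsTotal2Dominating : (G : Graph) → List (V G) → Set
IsTotal2Dominating G S = Unique S × (∀ v → 2 ≤ nbrsIn G v S)

γ2t≡ : Graph → ℕ → Set
γ2t≡ G k =
  (Σ (List (V G)) λ S → IsTotal2Dominating G S × length S ≡ k)
  × (∀ S → IsTotal2Dominating G S → k ≤ length S)
  where open import Data.Product using (Σ)

value : ℕ → ℕ
value n with n % 2 | n % 4
... | 0 | _ = (3 * n + 4) / 2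
... | _ | 1 = (3 * n + 3) / 2
... | _ | _ = (3 * n + 5) / 2

-- Write ρᵢ and κⱼ for the numbers of cells of S in row i and column j of Kₙ □ Kₘ. The vertex
-- (i, j) has ρᵢ + κⱼ − 2[(i, j) ∈ S] neighbours in S, so a total 2-dominating set has
-- ρᵢ + κⱼ ≥ 2 everywhere and ρᵢ + κⱼ ≥ 4 on S. If some line is empty then |S| ≥ 2n. Otherwise,
-- with a and b the numbers of cells of S alone in their row and in their column, a count over
-- the columns gives 6m + a ≤ 3|S| + 3b, over the rows 6n + b ≤ 3|S| + 3a, and a + b ≤ |S|.
-- For m = n + 2 these force 2|S| ≥ 3n + 3, and equality would make 2a odd when n ≡ 3 (mod 4).
-- Conversely, if n = r + P and n + 2 = c + Q with 3c ≤ P and 3r ≤ Q, the Q + P cells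
-- (x mod r, c + x) for x < Q and (r + x, x mod c) for x < P are total 2-dominating: every
-- vertex meets three of them along a line, or one of each kind.

module Submission where

open import Defs
open import Data.Nat using (NonZero; >-nonZero⁻¹; ℕ; zero; suc; _+_; _*_; _≤_; _<_; z≤n; s≤s; _≡ᵇ_; _≟_; _%_; _/_; _∸_; _<?_)
open import Data.Nat.DivMod using (_divMod_; result; m*n%n≡0; [m+kn]%n≡m%n; m%n<n; m<n⇒m%n≡m; +-distrib-/-∣ˡ)
open import Data.Nat.Divisibility using (divides-refl)
open import Data.Nat.Properties
open import Data.Bool using (Bool; true; false; _∧_)
open import Data.Bool.Properties using (∧-zeroʳ; ∧-identityʳ)
open import Data.Fin using (Fin; zero; suc; toℕ; fromℕ<)
open import Data.Fin.Patterns using (0F; 1F; 2F; 3F)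
open import Data.Fin.Properties using (any?; toℕ-injective; toℕ-fromℕ<; toℕ<n) renaming (_≟_ to _≟ᶠ_)
open import Data.List using (List; []; _∷_; length; filter; tabulate; _++_)
open import Data.List.Properties using (length-++; length-tabulate)
open import Data.List.Relation.Unary.Unique.Propositional using (Unique)
open import Data.List.Relation.Unary.Unique.Propositional.Properties using (++⁺; tabulate⁺)
open import Data.List.Membership.Propositional using (_∈_)
open import Data.List.Relation.Unary.Any using (here; there)
open import Data.List.Membership.Propositional.Properties using (∈-filter⁺; ∈-tabulate⁺; ∈-tabulate⁻; ∈-++⁺ˡ; ∈-++⁺ʳ)
open import Data.Product using (Σ; ∃; ∃₂; _×_; _,_; proj₁; proj₂)
open import Data.Sum using (_⊎_; inj₁; inj₂)
open import Function using (_∘_)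
open import Relation.Nullary using (Dec; yes; no; does; ¬_; contradiction)
open import Relation.Nullary.Decidable using (dec-true)
open import Level using (0ℓ)
open import Relation.Unary using (Pred; Decidable)
open import Relation.Binary.PropositionalEquality
open import Algebra.Properties.CommutativeSemigroup +-commutativeSemigroup using (interchange; x∙yz≈y∙xz; xy∙z≈xz∙y)
open import Data.Nat.Tactic.RingSolver using (solve)
open import Algebra.Properties.Semiring.Sum +-*-semiring using (sum; sum-syntax; ∑-distrib-+; *-distribˡ-sum)

𝟙 : Bool → ℕ
𝟙 true  = 1
𝟙 false = 0

𝟙≤1 : ∀ b → 𝟙 b ≤ 1
𝟙≤1 true  = ≤-refl
𝟙≤1 false = z≤n

module _ {A : Set} where

  count : (A → Bool) → List A → ℕ
  count f []       = 0
  count f (x ∷ xs) = 𝟙 (f x) + count f xs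

  length-filter≡count : ∀ {P : Pred A 0ℓ} (P? : Decidable P) xs →
                        length (filter P? xs) ≡ count (does ∘ P?) xs
  length-filter≡count P? []       = refl
  length-filter≡count P? (x ∷ xs) with does (P? x)
  ... | true  = cong suc (length-filter≡count P? xs)
  ... | false = length-filter≡count P? xs

  count-true : ∀ xs → count (λ _ → true) xs ≡ length xs
  count-true []       = refl
  count-true (x ∷ xs) = cong suc (count-true xs)

  count-≗ : ∀ {f g} → (∀ x → f x ≡ g x) → ∀ xs → count f xs ≡ count g xs
  count-≗ f≗g []       = refl
  count-≗ f≗g (x ∷ xs) = cong₂ _+_ (cong 𝟙 (f≗g x)) (count-≗ f≗g xs)

  count-mono : ∀ {f g} → (∀ x → 𝟙 (f x) ≤ 𝟙 (g x)) → ∀ xs → count f xs ≤ count g xs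
  count-mono f≤g []       = z≤n
  count-mono f≤g (x ∷ xs) = +-mono-≤ (f≤g x) (count-mono f≤g xs)

  count-none : ∀ f xs → (∀ x → x ∈ xs → f x ≡ false) → count f xs ≡ 0
  count-none f []       _    = refl
  count-none f (x ∷ xs) none rewrite none x (here refl) = count-none f xs (λ y → none y ∘ there)

  count-≤-+ : ∀ {f g h} → (∀ x → 𝟙 (f x) ≤ 𝟙 (g x) + 𝟙 (h x)) →
              ∀ xs → count f xs ≤ count g xs + count h xs
  count-≤-+ bound []       = z≤n
  count-≤-+ {f} {g} {h} bound (x ∷ xs) = begin
    𝟙 (f x) + count f xs                                ≤⟨ +-mono-≤ (bound x) (count-≤-+ bound xs) ⟩
    (𝟙 (g x) + 𝟙 (h x)) + (count g xs + count h xs)    ≡⟨ interchange (𝟙 (g x)) _ _ _ ⟩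
    (𝟙 (g x) + count g xs) + (𝟙 (h x) + count h xs)    ∎
    where open ≤-Reasoning

  count-+2≤-+ : ∀ {f g h x₀ xs} → (∀ x → 𝟙 (f x) ≤ 𝟙 (g x) + 𝟙 (h x)) →
                𝟙 (f x₀) + 2 ≤ 𝟙 (g x₀) + 𝟙 (h x₀) → x₀ ∈ xs →
                count f xs + 2 ≤ count g xs + count h xs
  count-+2≤-+ {f} {g} {h} {x₀} {_ ∷ xs} bound bonus (here refl) = begin
    (𝟙 (f x₀) + count f xs) + 2                          ≡⟨ xy∙z≈xz∙y (𝟙 (f x₀)) _ 2 ⟩
    (𝟙 (f x₀) + 2) + count f xs                          ≤⟨ +-mono-≤ bonus (count-≤-+ bound xs) ⟩
    (𝟙 (g x₀) + 𝟙 (h x₀)) + (count g xs + count h xs)   ≡⟨ interchange (𝟙 (g x₀)) _ _ _ ⟩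
    (𝟙 (g x₀) + count g xs) + (𝟙 (h x₀) + count h xs)   ∎
    where open ≤-Reasoning
  count-+2≤-+ {f} {g} {h} {x₀} {x ∷ xs} bound bonus (there x₀∈xs) = begin
    (𝟙 (f x) + count f xs) + 2                         ≡⟨ +-assoc (𝟙 (f x)) _ 2 ⟩
    𝟙 (f x) + (count f xs + 2)                         ≤⟨ +-mono-≤ (bound x) (count-+2≤-+ bound bonus x₀∈xs) ⟩
    (𝟙 (g x) + 𝟙 (h x)) + (count g xs + count h xs)   ≡⟨ interchange (𝟙 (g x)) _ _ _ ⟩
    (𝟙 (g x) + count g xs) + (𝟙 (h x) + count h xs)   ∎
    where open ≤-Reasoning

  count-+-≤-length : ∀ f g xs → (∀ x → x ∈ xs → 𝟙 (f x) + 𝟙 (g x) ≤ 1) →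
                     count f xs + count g xs ≤ length xs
  count-+-≤-length f g []       _        = z≤n
  count-+-≤-length f g (x ∷ xs) disjoint = begin
    (𝟙 (f x) + count f xs) + (𝟙 (g x) + count g xs)   ≡⟨ interchange (𝟙 (f x)) _ _ _ ⟩
    (𝟙 (f x) + 𝟙 (g x)) + (count f xs + count g xs)   ≤⟨ +-mono-≤ (disjoint x (here refl))
                                                           (count-+-≤-length f g xs (λ y → disjoint y ∘ there)) ⟩
    suc (length xs)                                    ∎
    where open ≤-Reasoning

sum-const : ∀ m c → ∑[ j < m ] c ≡ m * c
sum-const zero    c = refl
sum-const (suc m) c = cong (c +_) (sum-const m c)

sum-mono-≤ : ∀ {m} {f g : Fin m → ℕ} → (∀ j → f j ≤ g j) → sum f ≤ sum g
sum-mono-≤ {zero}  f≤g = z≤n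
sum-mono-≤ {suc m} f≤g = +-mono-≤ (f≤g zero) (sum-mono-≤ (f≤g ∘ suc))

sum-𝟙-≟ : ∀ {m} (x : Fin m) → ∑[ j < m ] 𝟙 (does (j ≟ᶠ x)) ≡ 1
sum-𝟙-≟ {suc m} zero    = cong suc (trans (sum-const m 0) (*-zeroʳ m))
sum-𝟙-≟ {suc m} (suc x) = sum-𝟙-≟ x

∑-count-fibres : ∀ {A : Set} {m} (f : A → Fin m) (g : A → Bool) xs →
                 ∑[ j < m ] count (λ s → g s ∧ does (j ≟ᶠ f s)) xs ≡ count g xs
∑-count-fibres {m = m} f g []       = trans (sum-const m 0) (*-zeroʳ m)
∑-count-fibres {m = m} f g (x ∷ xs) = begin
  ∑[ j < m ] (𝟙 (g x ∧ does (j ≟ᶠ f x)) + count (λ s → g s ∧ does (j ≟ᶠ f s)) xs)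
    ≡⟨ ∑-distrib-+ (λ j → 𝟙 (g x ∧ does (j ≟ᶠ f x))) _ ⟩
  ∑[ j < m ] 𝟙 (g x ∧ does (j ≟ᶠ f x)) + ∑[ j < m ] count (λ s → g s ∧ does (j ≟ᶠ f s)) xs
    ≡⟨ cong₂ _+_ (fibre (g x)) (∑-count-fibres f g xs) ⟩
  𝟙 (g x) + count g xs ∎
  where
  open ≡-Reasoning
  fibre : ∀ b → ∑[ j < m ] 𝟙 (b ∧ does (j ≟ᶠ f x)) ≡ 𝟙 b
  fibre true  = sum-𝟙-≟ (f x)
  fibre false = trans (sum-const m 0) (*-zeroʳ m)

-- Row and column counts

record CountingInequalities (n₁ n₂ k a b : ℕ) : Set where
  field
    columns  : 6 * n₂ + a ≤ 3 * k + 3 * b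
    rows     : 6 * n₁ + b ≤ 3 * k + 3 * a
    disjoint : a + b ≤ k

module LineCounts {A : Set} {n₁ n₂ : ℕ} (row : A → Fin n₁) (col : A → Fin n₂) (S : List A) where

  inRow : Fin n₁ → A → Bool
  inRow i s = does (i ≟ᶠ row s)

  inColumn : Fin n₂ → A → Bool
  inColumn j s = does (j ≟ᶠ col s)

  rowCount : Fin n₁ → ℕ
  rowCount i = count (inRow i) S

  columnCount : Fin n₂ → ℕ
  columnCount j = count (inColumn j) S

  aloneInRow aloneInColumn : A → Bool
  aloneInRow    s = rowCount (row s) ≡ᵇ 1
  aloneInColumn s = columnCount (col s) ≡ᵇ 1

  LinesCover : Set
  LinesCover = ∀ i j → 2 ≤ rowCount i + columnCount j

  MembersCovered : Set
  MembersCovered = ∀ s → s ∈ S → 4 ≤ rowCount (row s) + columnCount (col s)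

  columnCount-total : ∑[ j < n₂ ] columnCount j ≡ length S
  columnCount-total = trans (∑-count-fibres col (λ _ → true) S) (count-true S)

  empty-row-bound : LinesCover → ∀ i → rowCount i ≡ 0 → n₂ * 2 ≤ length S
  empty-row-bound cover i empty = subst₂ _≤_ (sum-const n₂ 2) columnCount-total
    (sum-mono-≤ λ j → subst (λ r → 2 ≤ r + columnCount j) empty (cover i j))

  rowAloneIn columnAloneIn : Fin n₂ → ℕ
  rowAloneIn    j = count (λ s → aloneInRow s ∧ inColumn j s) S
  columnAloneIn j = count (λ s → aloneInColumn s ∧ inColumn j s) S

  rowAloneIn≤columnCount : ∀ j → rowAloneIn j ≤ columnCount j
  rowAloneIn≤columnCount j = count-mono (λ s → 𝟙-∧ (aloneInRow s) (inColumn j s)) S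
    where
    𝟙-∧ : ∀ x y → 𝟙 (x ∧ y) ≤ 𝟙 y
    𝟙-∧ true  y = ≤-refl
    𝟙-∧ false y = z≤n

  rowAloneIn-short : MembersCovered → ∀ j → columnCount j ≤ 2 → rowAloneIn j ≡ 0
  rowAloneIn-short covered j short = count-none _ S notAlone
    where
    notAlone : ∀ s → s ∈ S → (aloneInRow s ∧ inColumn j s) ≡ false
    notAlone s s∈S with j ≟ᶠ col s
    ... | no  _    = ∧-zeroʳ _
    ... | yes refl = trans (∧-identityʳ _) (≥2⇒≢ᵇ1 two≤rowCount)
      where
      two≤rowCount : 2 ≤ rowCount (row s)
      two≤rowCount = +-cancelʳ-≤ 2 2 _ (≤-trans (covered s s∈S) (+-monoʳ-≤ _ short))
      ≥2⇒≢ᵇ1 : ∀ {r} → 2 ≤ r → (r ≡ᵇ 1) ≡ false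
      ≥2⇒≢ᵇ1 (s≤s (s≤s _)) = refl

  columnAloneIn-single : ∀ j → columnCount j ≡ 1 → columnAloneIn j ≡ 1
  columnAloneIn-single j single = trans (count-≗ alone≗inColumn S) single
    where
    alone≗inColumn : ∀ s → (aloneInColumn s ∧ inColumn j s) ≡ inColumn j s
    alone≗inColumn s with j ≟ᶠ col s
    ... | no  _    = ∧-zeroʳ _
    ... | yes refl rewrite single = refl

  -- A cell alone in its column has row count ≥ 3, and the two cells of a column of two
  -- have row count ≥ 2, so no cell of a column with at most two cells is alone in its row.
  column-contribution : MembersCovered → ∀ j → 1 ≤ columnCount j →
               6 + rowAloneIn j ≤ 3 * columnCount j + 3 * columnAloneIn j
  column-contribution covered j nonempty with columnCount j in eq
  ... | 1 rewrite rowAloneIn-short covered j (≤-trans (≤-reflexive eq) (s≤s z≤n))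
                | columnAloneIn-single j eq = ≤-refl
  ... | 2 rewrite rowAloneIn-short covered j (≤-reflexive eq) = m≤m+n 6 _
  ... | suc (suc (suc c)) = begin
    6 + rowAloneIn j             ≤⟨ +-monoʳ-≤ 6 (subst (rowAloneIn j ≤_) eq (rowAloneIn≤columnCount j)) ⟩
    6 + (3 + c)                  ≤⟨ m≤m+n _ (2 * c) ⟩
    6 + (3 + c) + 2 * c          ≡⟨ solve (c ∷ []) ⟩
    3 * (3 + c)                  ≤⟨ m≤m+n _ _ ⟩
    3 * (3 + c) + 3 * columnAloneIn j ∎
    where open ≤-Reasoning

  column-inequality : MembersCovered → (∀ j → 1 ≤ columnCount j) →
                      6 * n₂ + count aloneInRow S ≤ 3 * length S + 3 * count aloneInColumn S
  column-inequality covered nonempty = begin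
    6 * n₂ + count aloneInRow S
      ≡⟨ cong₂ _+_ (trans (*-comm 6 n₂) (sym (sum-const n₂ 6))) (sym (∑-count-fibres col aloneInRow S)) ⟩
    ∑[ j < n₂ ] 6 + ∑[ j < n₂ ] rowAloneIn j
      ≡⟨ ∑-distrib-+ (λ _ → 6) rowAloneIn ⟨
    ∑[ j < n₂ ] (6 + rowAloneIn j)
      ≤⟨ sum-mono-≤ (λ j → column-contribution covered j (nonempty j)) ⟩
    ∑[ j < n₂ ] (3 * columnCount j + 3 * columnAloneIn j)
      ≡⟨ ∑-distrib-+ (λ j → 3 * columnCount j) _ ⟩
    ∑[ j < n₂ ] (3 * columnCount j) + ∑[ j < n₂ ] (3 * columnAloneIn j)
      ≡⟨ cong₂ _+_ (*-distribˡ-sum 3 columnCount) (*-distribˡ-sum 3 columnAloneIn) ⟨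
    3 * ∑[ j < n₂ ] columnCount j + 3 * ∑[ j < n₂ ] columnAloneIn j
      ≡⟨ cong₂ (λ x y → 3 * x + 3 * y) columnCount-total (∑-count-fibres col aloneInColumn S) ⟩
    3 * length S + 3 * count aloneInColumn S ∎
    where open ≤-Reasoning

  alone-disjoint : MembersCovered → count aloneInRow S + count aloneInColumn S ≤ length S
  alone-disjoint covered = count-+-≤-length aloneInRow aloneInColumn S λ s s∈S →
    not-both (rowCount (row s)) (columnCount (col s)) (covered s s∈S)
    where
    not-both : ∀ x y → 4 ≤ x + y → 𝟙 (x ≡ᵇ 1) + 𝟙 (y ≡ᵇ 1) ≤ 1
    not-both 1             1 (s≤s (s≤s ()))
    not-both 0             y _ = 𝟙≤1 (y ≡ᵇ 1)
    not-both (suc (suc x)) y _ = 𝟙≤1 (y ≡ᵇ 1)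
    not-both 1             0 _ = ≤-refl
    not-both 1 (suc (suc y)) _ = ≤-refl

line-count-cases : ∀ {A : Set} {n₁ n₂} (row : A → Fin n₁) (col : A → Fin n₂) (S : List A) →
                   LineCounts.LinesCover row col S → LineCounts.MembersCovered row col S →
                   n₁ * 2 ≤ length S ⊎ n₂ * 2 ≤ length S ⊎ ∃₂ (CountingInequalities n₁ n₂ (length S))
line-count-cases {n₁ = n₁} {n₂} row col S cover covered =
  cases (any? (λ i → rowCount i ≟ 0)) (any? (λ j → columnCount j ≟ 0))
  where
  open LineCounts row col S
  module T = LineCounts col row S

  cover′ : T.LinesCover
  cover′ j i = subst (2 ≤_) (+-comm (rowCount i) (columnCount j)) (cover i j)

  covered′ : T.MembersCovered
  covered′ s s∈S = subst (4 ≤_) (+-comm (rowCount (row s)) (columnCount (col s))) (covered s s∈S)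

  cases : Dec (∃ λ i → rowCount i ≡ 0) → Dec (∃ λ j → columnCount j ≡ 0) →
          n₁ * 2 ≤ length S ⊎ n₂ * 2 ≤ length S ⊎ ∃₂ (CountingInequalities n₁ n₂ (length S))
  cases (yes (i , empty)) _                = inj₂ (inj₁ (empty-row-bound cover i empty))
  cases (no _)            (yes (j , empty)) = inj₁ (T.empty-row-bound cover′ j empty)
  cases (no noEmptyRow)   (no noEmptyColumn) = inj₂ (inj₂ (_ , _ , record
    { columns  = column-inequality covered (λ j → n≢0⇒n>0 (λ empty → noEmptyColumn (j , empty)))
    ; rows     = T.column-inequality covered′ (λ i → n≢0⇒n>0 (λ empty → noEmptyRow (i , empty)))
    ; disjoint = alone-disjoint covered }))

module _ {n m : ℕ} where

  private
    sameRow sameColumn adjacent : Fin n × Fin m → Fin n × Fin m → Bool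
    sameRow    (i , _) (i′ , _) = does (i ≟ᶠ i′)
    sameColumn (_ , j) (_ , j′) = does (j ≟ᶠ j′)
    adjacent   v x              = does (adj? (K n □ K m) v x)

    adjacent≤sameRow+sameColumn : ∀ v x → 𝟙 (adjacent v x) ≤ 𝟙 (sameRow v x) + 𝟙 (sameColumn v x)
    adjacent≤sameRow+sameColumn (i , j) (i′ , j′) with does (i ≟ᶠ i′) | does (j ≟ᶠ j′)
    ... | true  | true  = z≤n
    ... | true  | false = ≤-refl
    ... | false | true  = ≤-refl
    ... | false | false = z≤n

    not-self-adjacent : ∀ v → 𝟙 (adjacent v v) + 2 ≤ 𝟙 (sameRow v v) + 𝟙 (sameColumn v v)
    not-self-adjacent (i , j) rewrite dec-true (i ≟ᶠ i) refl | dec-true (j ≟ᶠ j) refl = ≤-refl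

  total2Dominating⇒lineCounts : ∀ S → IsTotal2Dominating (K n □ K m) S →
    LineCounts.LinesCover proj₁ proj₂ S × LineCounts.MembersCovered proj₁ proj₂ S
  total2Dominating⇒lineCounts S (_ , dominated) = cover , covered
    where
    two-neighbours : ∀ v → 2 ≤ count (adjacent v) S
    two-neighbours v = subst (2 ≤_) (length-filter≡count (adj? (K n □ K m) v) S) (dominated v)

    cover : LineCounts.LinesCover proj₁ proj₂ S
    cover i j = ≤-trans (two-neighbours (i , j)) (count-≤-+ (adjacent≤sameRow+sameColumn (i , j)) S)

    covered : LineCounts.MembersCovered proj₁ proj₂ S
    covered v v∈S = ≤-trans (+-monoˡ-≤ 2 (two-neighbours v))
      (count-+2≤-+ (adjacent≤sameRow+sameColumn v) (not-self-adjacent v) v∈S)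

-- The lower bound

module _ {n k a b : ℕ} (ineq : CountingInequalities n (n + 2) k a b) where
  open CountingInequalities ineq
  open ≤-Reasoning

  twice-aloneInRow-lower : 6 * n + 3 ≤ 3 * k + 2 * a
  twice-aloneInRow-lower = *-cancelˡ-≤ 4 (+-cancelʳ-≤ (a + 3 * b) _ _ (begin
    4 * (6 * n + 3) + (a + 3 * b)      ≡⟨ solve (n ∷ a ∷ b ∷ []) ⟩
    3 * (6 * n + b) + (6 * (n + 2) + a) ≤⟨ +-mono-≤ (*-monoʳ-≤ 3 rows) columns ⟩
    3 * (3 * k + 3 * a) + (3 * k + 3 * b) ≡⟨ solve (k ∷ a ∷ b ∷ []) ⟩
    4 * (3 * k + 2 * a) + (a + 3 * b)  ∎))

  twice-aloneInRow-upper : 3 * n + 6 + 2 * a ≤ 3 * k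
  twice-aloneInRow-upper = *-cancelˡ-≤ 2 (+-cancelʳ-≤ (3 * b) _ _ (begin
    2 * (3 * n + 6 + 2 * a) + 3 * b    ≡⟨ solve (n ∷ a ∷ b ∷ []) ⟩
    6 * (n + 2) + a + 3 * (a + b)      ≤⟨ +-mono-≤ columns (*-monoʳ-≤ 3 disjoint) ⟩
    3 * k + 3 * b + 3 * k              ≡⟨ solve (k ∷ b ∷ []) ⟩
    2 * (3 * k) + 3 * b                ∎))

  counting⇒3n+3≤2k : 3 * n + 3 ≤ 2 * k
  counting⇒3n+3≤2k = *-cancelˡ-≤ 3 (+-cancelʳ-≤ (2 * a) _ _ (begin
    3 * (3 * n + 3) + 2 * a             ≡⟨ solve (n ∷ a ∷ []) ⟩
    (6 * n + 3) + (3 * n + 6 + 2 * a)   ≤⟨ +-mono-≤ twice-aloneInRow-lower twice-aloneInRow-upper ⟩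
    (3 * k + 2 * a) + 3 * k             ≡⟨ solve (k ∷ a ∷ []) ⟩
    3 * (2 * k) + 2 * a                 ∎))

2*≢1+2* : ∀ x y → 2 * x ≢ 1 + 2 * y
2*≢1+2* x y even≡odd = 0≢1+n (begin
  0               ≡⟨ m*n%n≡0 x 2 ⟨
  (x * 2) % 2     ≡⟨ cong (_% 2) (trans (*-comm x 2) (trans even≡odd (cong suc (*-comm 2 y)))) ⟩
  (1 + y * 2) % 2 ≡⟨ [m+kn]%n≡m%n 1 y 2 ⟩
  1               ∎)
  where open ≡-Reasoning

-- Equality 2k = 3n + 3 pins 2a between two bounds that meet at the odd number 6q + 3.
counting-not-tight : ∀ q {a b} → ¬ CountingInequalities (3 + q * 4) (3 + q * 4 + 2) (6 + q * 6) a b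
counting-not-tight q {a} ineq = 2*≢1+2* a (3 * q + 1) (≤-antisym upper lower)
  where
  open ≤-Reasoning
  lower : 1 + 2 * (3 * q + 1) ≤ 2 * a
  lower = +-cancelʳ-≤ (q * 18 + 18) _ _ (begin
    1 + 2 * (3 * q + 1) + (q * 18 + 18)  ≡⟨ solve (q ∷ []) ⟩
    6 * (3 + q * 4) + 3                 ≤⟨ twice-aloneInRow-lower ineq ⟩
    3 * (6 + q * 6) + 2 * a             ≡⟨ solve (q ∷ a ∷ []) ⟩
    2 * a + (q * 18 + 18)               ∎)
  upper : 2 * a ≤ 1 + 2 * (3 * q + 1)
  upper = +-cancelʳ-≤ (q * 12 + 15) _ _ (begin
    2 * a + (q * 12 + 15)               ≡⟨ solve (q ∷ a ∷ []) ⟩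
    3 * (3 + q * 4) + 6 + 2 * a         ≤⟨ twice-aloneInRow-upper ineq ⟩
    3 * (6 + q * 6)                     ≡⟨ solve (q ∷ []) ⟩
    1 + 2 * (3 * q + 1) + (q * 12 + 15) ∎)

module _ (n : ℕ) (S : List (Fin n × Fin (n + 2))) (t2d : IsTotal2Dominating (K n □ K (n + 2)) S) where

  grid-cases : n * 2 ≤ length S ⊎ ∃₂ (CountingInequalities n (n + 2) (length S))
  grid-cases with line-count-cases proj₁ proj₂ S (proj₁ counts) (proj₂ counts)
    where counts = total2Dominating⇒lineCounts S t2d
  ... | inj₁ n*2≤k            = inj₁ n*2≤k
  ... | inj₂ (inj₁ [n+2]*2≤k) = inj₁ (≤-trans (*-monoˡ-≤ 2 (m≤m+n n 2)) [n+2]*2≤k)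
  ... | inj₂ (inj₂ ineq)      = inj₂ ineq

  lower-bound : 3 ≤ n → 3 * n + 3 ≤ 2 * length S
  lower-bound 3≤n with grid-cases
  ... | inj₁ n*2≤k = begin
    3 * n + 3     ≤⟨ +-monoʳ-≤ (3 * n) 3≤n ⟩
    3 * n + n     ≡⟨ solve (n ∷ []) ⟩
    2 * (n * 2)   ≤⟨ *-monoʳ-≤ 2 n*2≤k ⟩
    2 * length S  ∎
    where open ≤-Reasoning
  ... | inj₂ (_ , _ , ineq) = counting⇒3n+3≤2k ineq

lower-bound-not-tight : ∀ q .{{_ : NonZero q}} S →
                        IsTotal2Dominating (K (3 + q * 4) □ K (3 + q * 4 + 2)) S → length S ≢ 6 + q * 6
lower-bound-not-tight q S t2d tight with grid-cases (3 + q * 4) S t2d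
... | inj₁ n*2≤k = <⇒≱ (begin-strict
  6 + q * 6               <⟨ m<m+n (6 + q * 6) (*-monoʳ-< 2 (>-nonZero⁻¹ q)) ⟩
  6 + q * 6 + 2 * q       ≡⟨ solve (q ∷ []) ⟩
  (3 + q * 4) * 2         ≤⟨ n*2≤k ⟩
  length S                ≡⟨ tight ⟩
  6 + q * 6               ∎) ≤-refl
  where open ≤-Reasoning
... | inj₂ (_ , _ , ineq) = counting-not-tight q (subst (λ k → CountingInequalities _ _ k _ _) tight ineq)

-- The construction

distinct-members⇒2≤length : ∀ {A : Set} {x y : A} xs → x ∈ xs → y ∈ xs → x ≢ y → 2 ≤ length xs
distinct-members⇒2≤length (_ ∷ [])    (here refl) (here refl) x≢y = contradiction refl x≢y
distinct-members⇒2≤length (_ ∷ _ ∷ _) _           _           _   = s≤s (s≤s z≤n)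

two-neighbours⇒2≤nbrsIn : ∀ (G : Graph) {v x y S} → x ∈ S → y ∈ S → x ≢ y →
                          Adj G v x → Adj G v y → 2 ≤ nbrsIn G v S
two-neighbours⇒2≤nbrsIn G {v} x∈S y∈S x≢y v~x v~y =
  distinct-members⇒2≤length _ (∈-filter⁺ (adj? G v) x∈S v~x) (∈-filter⁺ (adj? G v) y∈S v~y) x≢y

module _ {n m : ℕ} (S : List (Fin n × Fin m)) where

  record CellAt (R C : ℕ) : Set where
    constructor cellAt
    field
      cell   : Fin n × Fin m
      ∈S     : cell ∈ S
      toℕ-row : toℕ (proj₁ cell) ≡ R
      toℕ-col : toℕ (proj₂ cell) ≡ C

  open CellAt

  module _ {i : Fin n} {j : Fin m} where

    private
      G = K n □ K m

    adjacent-in-row : ∀ {C} (w : CellAt (toℕ i) C) → C ≢ toℕ j → Adj G (i , j) (cell w)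
    adjacent-in-row w C≢j = inj₁ (toℕ-injective (sym (toℕ-row w)) ,
                                  λ j≡ → C≢j (trans (sym (toℕ-col w)) (cong toℕ (sym j≡))))

    adjacent-in-column : ∀ {R} (w : CellAt R (toℕ j)) → R ≢ toℕ i → Adj G (i , j) (cell w)
    adjacent-in-column w R≢i = inj₂ (toℕ-injective (sym (toℕ-col w)) ,
                                     λ i≡ → R≢i (trans (sym (toℕ-row w)) (cong toℕ (sym i≡))))

    two-cells : ∀ {R₁ C₁ R₂ C₂} (w₁ : CellAt R₁ C₁) (w₂ : CellAt R₂ C₂) → R₁ ≢ R₂ ⊎ C₁ ≢ C₂ →
                Adj G (i , j) (cell w₁) → Adj G (i , j) (cell w₂) → 2 ≤ nbrsIn G (i , j) S
    two-cells w₁ w₂ apart = two-neighbours⇒2≤nbrsIn G (∈S w₁) (∈S w₂) (different apart)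
      where
      different : _ → cell w₁ ≢ cell w₂
      different (inj₁ R₁≢R₂) same =
        R₁≢R₂ (trans (sym (toℕ-row w₁)) (trans (cong (toℕ ∘ proj₁) same) (toℕ-row w₂)))
      different (inj₂ C₁≢C₂) same =
        C₁≢C₂ (trans (sym (toℕ-col w₁)) (trans (cong (toℕ ∘ proj₂) same) (toℕ-col w₂)))

    three-in-row : ∀ {C₁ C₂ C₃} → CellAt (toℕ i) C₁ → CellAt (toℕ i) C₂ → CellAt (toℕ i) C₃ →
                   C₁ ≢ C₂ → C₁ ≢ C₃ → C₂ ≢ C₃ → 2 ≤ nbrsIn G (i , j) S
    three-in-row {C₁} {C₂} w₁ w₂ w₃ C₁≢C₂ C₁≢C₃ C₂≢C₃ with toℕ j ≟ C₁ | toℕ j ≟ C₂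
    ... | yes refl | _        = two-cells w₂ w₃ (inj₂ C₂≢C₃)
      (adjacent-in-row w₂ (C₁≢C₂ ∘ sym)) (adjacent-in-row w₃ (C₁≢C₃ ∘ sym))
    ... | no j≢C₁  | yes refl = two-cells w₁ w₃ (inj₂ C₁≢C₃)
      (adjacent-in-row w₁ (j≢C₁ ∘ sym)) (adjacent-in-row w₃ (C₂≢C₃ ∘ sym))
    ... | no j≢C₁  | no j≢C₂  = two-cells w₁ w₂ (inj₂ C₁≢C₂)
      (adjacent-in-row w₁ (j≢C₁ ∘ sym)) (adjacent-in-row w₂ (j≢C₂ ∘ sym))

    three-in-column : ∀ {R₁ R₂ R₃} → CellAt R₁ (toℕ j) → CellAt R₂ (toℕ j) → CellAt R₃ (toℕ j) →
                      R₁ ≢ R₂ → R₁ ≢ R₃ → R₂ ≢ R₃ → 2 ≤ nbrsIn G (i , j) S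
    three-in-column {R₁} {R₂} w₁ w₂ w₃ R₁≢R₂ R₁≢R₃ R₂≢R₃ with toℕ i ≟ R₁ | toℕ i ≟ R₂
    ... | yes refl | _        = two-cells w₂ w₃ (inj₁ R₂≢R₃)
      (adjacent-in-column w₂ (R₁≢R₂ ∘ sym)) (adjacent-in-column w₃ (R₁≢R₃ ∘ sym))
    ... | no i≢R₁  | yes refl = two-cells w₁ w₃ (inj₁ R₁≢R₃)
      (adjacent-in-column w₁ (i≢R₁ ∘ sym)) (adjacent-in-column w₃ (R₂≢R₃ ∘ sym))
    ... | no i≢R₁  | no i≢R₂  = two-cells w₁ w₂ (inj₁ R₁≢R₂)
      (adjacent-in-column w₁ (i≢R₁ ∘ sym)) (adjacent-in-column w₂ (i≢R₂ ∘ sym))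

    cross : ∀ {R C} (w₁ : CellAt R (toℕ j)) (w₂ : CellAt (toℕ i) C) → R ≢ toℕ i → C ≢ toℕ j →
            2 ≤ nbrsIn G (i , j) S
    cross w₁ w₂ R≢i C≢j = two-cells w₁ w₂ (inj₁ R≢i) (adjacent-in-column w₁ R≢i) (adjacent-in-row w₂ C≢j)

[i+td]%d≡i : ∀ {d i} t .{{_ : NonZero d}} → i < d → (i + t * d) % d ≡ i
[i+td]%d≡i {d} {i} t i<d = trans ([m+kn]%n≡m%n i t d) (m<n⇒m%n≡m i<d)

progression-apart : ∀ a x d .{{_ : NonZero d}} {t t′} → t ≢ t′ → a + (x + t * d) ≢ a + (x + t′ * d)
progression-apart a x d {t} {t′} t≢t′ eq =
  t≢t′ (*-cancelʳ-≡ t t′ d (+-cancelˡ-≡ x _ _ (+-cancelˡ-≡ a _ _ eq)))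

i+td<3d : ∀ {d i t} → i < d → t ≤ 2 → i + t * d < 3 * d
i+td<3d {d} {i} {t} i<d t≤2 = <-≤-trans (+-monoˡ-< (t * d) i<d) (*-monoˡ-≤ d (s≤s t≤2))

m≤x<m+n⇒x∸m<n : ∀ {m n x} → m ≤ x → x < m + n → x ∸ m < n
m≤x<m+n⇒x∸m<n {m} m≤x x<m+n = +-cancelˡ-< m _ _ (subst (_< m + _) (sym (m+[n∸m]≡n m≤x)) x<m+n)

module Construction (r c P Q : ℕ) .{{_ : NonZero r}} .{{_ : NonZero c}}
                    (3r≤Q : 3 * r ≤ Q) (3c≤P : 3 * c ≤ P) where

  Cell : Set
  Cell = Fin (r + P) × Fin (c + Q)

  rowPart : Fin Q → Cell
  rowPart k = fromℕ< (<-≤-trans (m%n<n (toℕ k) r) (m≤m+n r P)) , fromℕ< (+-monoʳ-< c (toℕ<n k))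

  columnPart : Fin P → Cell
  columnPart k = fromℕ< (+-monoʳ-< r (toℕ<n k)) , fromℕ< (<-≤-trans (m%n<n (toℕ k) c) (m≤m+n c Q))

  S : List Cell
  S = tabulate rowPart ++ tabulate columnPart

  length-S : length S ≡ Q + P
  length-S = trans (length-++ (tabulate rowPart))
                   (cong₂ _+_ (length-tabulate rowPart) (length-tabulate columnPart))

  toℕ-row-rowPart : ∀ k → toℕ (proj₁ (rowPart k)) ≡ toℕ k % r
  toℕ-row-rowPart k = toℕ-fromℕ< _

  toℕ-col-rowPart : ∀ k → toℕ (proj₂ (rowPart k)) ≡ c + toℕ k
  toℕ-col-rowPart k = toℕ-fromℕ< _

  toℕ-row-columnPart : ∀ k → toℕ (proj₁ (columnPart k)) ≡ r + toℕ k
  toℕ-row-columnPart k = toℕ-fromℕ< _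

  toℕ-col-columnPart : ∀ k → toℕ (proj₂ (columnPart k)) ≡ toℕ k % c
  toℕ-col-columnPart k = toℕ-fromℕ< _

  unique-S : Unique S
  unique-S = ++⁺ (tabulate⁺ rowPart-injective) (tabulate⁺ columnPart-injective) disjoint
    where
    rowPart-injective : ∀ {k k′} → rowPart k ≡ rowPart k′ → k ≡ k′
    rowPart-injective {k} {k′} eq = toℕ-injective (+-cancelˡ-≡ c _ _
      (trans (sym (toℕ-col-rowPart k)) (trans (cong (toℕ ∘ proj₂) eq) (toℕ-col-rowPart k′))))
    columnPart-injective : ∀ {k k′} → columnPart k ≡ columnPart k′ → k ≡ k′
    columnPart-injective {k} {k′} eq = toℕ-injective (+-cancelˡ-≡ r _ _
      (trans (sym (toℕ-row-columnPart k)) (trans (cong (toℕ ∘ proj₁) eq) (toℕ-row-columnPart k′))))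
    disjoint : ∀ {v} → ¬ (v ∈ tabulate rowPart × v ∈ tabulate columnPart)
    disjoint (v∈rows , v∈columns) with ∈-tabulate⁻ v∈rows | ∈-tabulate⁻ v∈columns
    ... | k , refl | k′ , eq = <⇒≱ (m%n<n (toℕ k′) c) (begin
      c                           ≤⟨ m≤m+n c (toℕ k) ⟩
      c + toℕ k                   ≡⟨ toℕ-col-rowPart k ⟨
      toℕ (proj₂ (rowPart k))     ≡⟨ cong (toℕ ∘ proj₂) eq ⟩
      toℕ (proj₂ (columnPart k′)) ≡⟨ toℕ-col-columnPart k′ ⟩
      toℕ k′ % c                  ∎)
      where open ≤-Reasoning

  rowPart-cell : ∀ x → x < Q → CellAt S (x % r) (c + x)
  rowPart-cell x x<Q = cellAt (rowPart k) (∈-++⁺ˡ (∈-tabulate⁺ k))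
    (trans (toℕ-row-rowPart k) (cong (_% r) (toℕ-fromℕ< x<Q)))
    (trans (toℕ-col-rowPart k) (cong (c +_) (toℕ-fromℕ< x<Q)))
    where k = fromℕ< x<Q

  columnPart-cell : ∀ x → x < P → CellAt S (r + x) (x % c)
  columnPart-cell x x<P = cellAt (columnPart k) (∈-++⁺ʳ (tabulate rowPart) (∈-tabulate⁺ k))
    (trans (toℕ-row-columnPart k) (cong (r +_) (toℕ-fromℕ< x<P)))
    (trans (toℕ-col-columnPart k) (cong (_% c) (toℕ-fromℕ< x<P)))
    where k = fromℕ< x<P

  row-progression : ∀ {i} → i < r → ∀ t → t ≤ 2 → CellAt S i (c + (i + t * r))
  row-progression {i} i<r t t≤2 = subst (λ R → CellAt S R (c + (i + t * r))) ([i+td]%d≡i t i<r)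
    (rowPart-cell _ (<-≤-trans (i+td<3d i<r t≤2) 3r≤Q))

  column-progression : ∀ {j} → j < c → ∀ t → t ≤ 2 → CellAt S (r + (j + t * c)) j
  column-progression j<c t t≤2 = subst (CellAt S _) ([i+td]%d≡i t j<c)
    (columnPart-cell _ (<-≤-trans (i+td<3d j<c t≤2) 3c≤P))

  G : Graph
  G = K (r + P) □ K (c + Q)

  row-dominated : ∀ {i} → toℕ i < r → ∀ j → 2 ≤ nbrsIn G (i , j) S
  row-dominated {i} i<r j = three-in-row S
    (row-progression i<r 0 z≤n) (row-progression i<r 1 (s≤s z≤n)) (row-progression i<r 2 ≤-refl)
    (apart {0} {1} (λ ())) (apart {0} {2} (λ ())) (apart {1} {2} (λ ()))
    where
    apart : ∀ {t t′} → t ≢ t′ → c + (toℕ i + t * r) ≢ c + (toℕ i + t′ * r)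
    apart = progression-apart c (toℕ i) r

  column-dominated : ∀ {j} → toℕ j < c → ∀ i → 2 ≤ nbrsIn G (i , j) S
  column-dominated {j} j<c i = three-in-column S
    (column-progression j<c 0 z≤n) (column-progression j<c 1 (s≤s z≤n)) (column-progression j<c 2 ≤-refl)
    (apart {0} {1} (λ ())) (apart {0} {2} (λ ())) (apart {1} {2} (λ ()))
    where
    apart : ∀ {t t′} → t ≢ t′ → r + (toℕ j + t * c) ≢ r + (toℕ j + t′ * c)
    apart = progression-apart r (toℕ j) c

  corner-dominated : ∀ {i j} → r ≤ toℕ i → c ≤ toℕ j → 2 ≤ nbrsIn G (i , j) S
  corner-dominated {i} {j} r≤i c≤j = cross S in-column in-row
    (<⇒≢ (<-≤-trans (m%n<n _ r) r≤i)) (<⇒≢ (<-≤-trans (m%n<n _ c) c≤j))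
    where
    in-column : CellAt S ((toℕ j ∸ c) % r) (toℕ j)
    in-column = subst (CellAt S _) (m+[n∸m]≡n c≤j)
      (rowPart-cell _ (m≤x<m+n⇒x∸m<n c≤j (toℕ<n j)))
    in-row : CellAt S (toℕ i) ((toℕ i ∸ r) % c)
    in-row = subst (λ R → CellAt S R ((toℕ i ∸ r) % c)) (m+[n∸m]≡n r≤i)
      (columnPart-cell _ (m≤x<m+n⇒x∸m<n r≤i (toℕ<n i)))

  dominated : ∀ v → 2 ≤ nbrsIn G v S
  dominated (i , j) with toℕ i <? r | toℕ j <? c
  ... | yes i<r | _       = row-dominated i<r j
  ... | no _    | yes j<c = column-dominated j<c i
  ... | no i≮r  | no j≮c  = corner-dominated (≮⇒≥ i≮r) (≮⇒≥ j≮c)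

Total2DominatingOfSize : Graph → ℕ → Set
Total2DominatingOfSize G k = Σ (List (V G)) λ S → IsTotal2Dominating G S × length S ≡ k

construction : ∀ {n k} r c P Q .{{_ : NonZero r}} .{{_ : NonZero c}} → 3 * r ≤ Q → 3 * c ≤ P →
               r + P ≡ n → c + Q ≡ n + 2 → Q + P ≡ k → Total2DominatingOfSize (K n □ K (n + 2)) k
construction r c P Q 3r≤Q 3c≤P refl c+Q≡n+2 refl =
  subst (λ m → Total2DominatingOfSize (K (r + P) □ K m) (Q + P)) c+Q≡n+2
        (S , (unique-S , dominated) , length-S)
  where open Construction r c P Q 3r≤Q 3c≤P

-- The value modulo 4

value-formula-+4 : ∀ n c → (3 * (4 + n) + c) / 2 ≡ 6 + (3 * n + c) / 2
value-formula-+4 n c = begin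
  (3 * (4 + n) + c) / 2    ≡⟨ cong (_/ 2) {3 * (4 + n) + c} {12 + (3 * n + c)} (solve (n ∷ c ∷ [])) ⟩
  (12 + (3 * n + c)) / 2   ≡⟨ +-distrib-/-∣ˡ (3 * n + c) {2} (divides-refl 6) ⟩
  6 + (3 * n + c) / 2      ∎
  where open ≡-Reasoning

value-+4 : ∀ n → value (4 + n) ≡ 6 + value n
value-+4 n with n % 2 | n % 4
... | 0     | _           = value-formula-+4 n 4
... | suc _ | 0           = value-formula-+4 n 5
... | suc _ | 1           = value-formula-+4 n 3
... | suc _ | suc (suc _) = value-formula-+4 n 5

value-periodic : ∀ e q → value (e + q * 4) ≡ value e + q * 6
value-periodic e zero    = trans (cong value (+-identityʳ e)) (sym (+-identityʳ (value e)))
value-periodic e (suc q) = begin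
  value (e + (4 + q * 4))   ≡⟨ cong value {e + (4 + q * 4)} {4 + (e + q * 4)} (solve (e ∷ q ∷ [])) ⟩
  value (4 + (e + q * 4))   ≡⟨ value-+4 (e + q * 4) ⟩
  6 + value (e + q * 4)     ≡⟨ cong (6 +_) (value-periodic e q) ⟩
  6 + (value e + q * 6)     ≡⟨ x∙yz≈y∙xz 6 (value e) (q * 6) ⟩
  value e + (6 + q * 6)     ∎
  where open ≡-Reasoning

quotient-nonZero : ∀ (e : Fin 4) q → 4 ≤ toℕ e + q * 4 → NonZero q
quotient-nonZero e zero    4≤e = contradiction (subst (4 ≤_) (+-identityʳ (toℕ e)) 4≤e) (<⇒≱ (toℕ<n e))
quotient-nonZero e (suc q) _   = _

upper-residue : ∀ (e : Fin 4) q .{{_ : NonZero q}} →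
                Total2DominatingOfSize (K (toℕ e + q * 4) □ K (toℕ e + q * 4 + 2)) (value (toℕ e) + q * 6)
upper-residue 0F q = construction {0 + q * 4} {2 + q * 6} q q (3 * q) (2 + 3 * q) (m≤n+m _ 2) ≤-refl
  (solve (q ∷ [])) (solve (q ∷ [])) (solve (q ∷ []))
upper-residue 1F q = construction {1 + q * 4} {3 + q * 6} (1 + q) q (3 * q) (3 * (1 + q)) ≤-refl ≤-refl
  (solve (q ∷ [])) (solve (q ∷ [])) (solve (q ∷ []))
upper-residue 2F q = construction {2 + q * 4} {5 + q * 6} (1 + q) q (1 + 3 * q) (1 + 3 * (1 + q))
  (m≤n+m _ 1) (m≤n+m _ 1) (solve (q ∷ [])) (solve (q ∷ [])) (solve (q ∷ []))
upper-residue 3F q = construction {3 + q * 4} {7 + q * 6} (1 + q) q (2 + 3 * q) (2 + 3 * (1 + q))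
  (m≤n+m _ 2) (m≤n+m _ 2) (solve (q ∷ [])) (solve (q ∷ [])) (solve (q ∷ []))

lower-residue : ∀ (e : Fin 4) q .{{_ : NonZero q}} → 4 ≤ toℕ e + q * 4 →
                ∀ S → IsTotal2Dominating (K (toℕ e + q * 4) □ K (toℕ e + q * 4 + 2)) S →
                value (toℕ e) + q * 6 ≤ length S
lower-residue 0F q 4≤n S t2d = *-cancelˡ-< 2 (1 + q * 6) (length S) (begin-strict
  2 * (1 + q * 6)         <⟨ n<1+n _ ⟩
  1 + 2 * (1 + q * 6)     ≡⟨ solve (q ∷ []) ⟩
  3 * (q * 4) + 3         ≤⟨ lower-bound _ S t2d (<⇒≤ 4≤n) ⟩
  2 * length S            ∎)
  where open ≤-Reasoning
lower-residue 1F q 4≤n S t2d = *-cancelˡ-≤ 2 (begin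
  2 * (3 + q * 6)         ≡⟨ solve (q ∷ []) ⟩
  3 * (1 + q * 4) + 3     ≤⟨ lower-bound _ S t2d (<⇒≤ 4≤n) ⟩
  2 * length S            ∎)
  where open ≤-Reasoning
lower-residue 2F q 4≤n S t2d = *-cancelˡ-< 2 (4 + q * 6) (length S) (begin-strict
  2 * (4 + q * 6)         <⟨ n<1+n _ ⟩
  1 + 2 * (4 + q * 6)     ≡⟨ solve (q ∷ []) ⟩
  3 * (2 + q * 4) + 3     ≤⟨ lower-bound _ S t2d (<⇒≤ 4≤n) ⟩
  2 * length S            ∎)
  where open ≤-Reasoning
lower-residue 3F q 4≤n S t2d = ≤∧≢⇒< (*-cancelˡ-≤ 2 (begin
  2 * (6 + q * 6)         ≡⟨ solve (q ∷ []) ⟩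
  3 * (3 + q * 4) + 3     ≤⟨ lower-bound _ S t2d (<⇒≤ 4≤n) ⟩
  2 * length S            ∎))
  (lower-bound-not-tight q S t2d ∘ sym)
  where open ≤-Reasoning

theorem2p16 : (n : ℕ) → 4 ≤ n → γ2t≡ (K n □ K (n + 2)) (value n)
theorem2p16 n 4≤n with n divMod 4
... | result q e refl = subst (γ2t≡ (K n □ K (n + 2))) (sym (value-periodic (toℕ e) q))
  (upper-residue e q , lower-residue e q 4≤n)
  where instance _ = quotient-nonZero e q 4≤n
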